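{- Let $m,n\ge1$, $N=m+n\ge4$ and $g\ge0$. The number $\mathsf{T}^{mn}_g(000)$ of binary words of length $N$ with $m$ zeros and $n$ ones in which $000$ occurs (cyclically) exactly $g$ times is $$\mathsf{T}^{mn}_{g}(000)=\sum_{h=1}^{\min(m,n)}\frac{N}{h}\,c'^{\,mg}_{h}\binom{n-1}{h-1}=\frac{N}{n}\sum_{h=1}^{\min(m,n)}c'^{\,mg}_{h}\binom{n}{h}.$$
   Context: Occurrences are cyclic: for $S=\alpha_1\cdots\alpha_N$ and a word $U$ with $|U|<N$, count the $i\in\{1,\dots,N\}$ with $\alpha_i\cdots\alpha_{i+|U|-1}=U$, indices modulo $N$. Binomial coefficients $\binom ab$ are $0$ unless $0\le b\le a$. For $1\le h\le m$: $c'^{\,mg}_{h}=\frac1g\sum_{\ell\ge0}\ell\binom{h}{\ell}\binom{g}{\ell}\binom{h-\ell}{m-g-h-\ell}$ for $g\ne0$ and $c'^{\,m0}_h=\binom{h}{m-h}$; equivalently $c'^{\,mg}_h$ is the number of compositions $(a_1,\dots,a_h)$ of $m$ into $h$ positive parts with $\sum_i\max(a_i-2,0)=g$. -}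

module Defs where

open import Data.Bool using (Bool; true; false)
open import Data.List using (List; []; _∷_; _++_; map; take; length; filter)
open import Data.Nat using (ℕ; zero; suc; _+_; _*_; _∸_)
open import Data.Nat.Combinatorics using (_C_)
open import Data.Integer as ℤ using (ℤ; +_; -[1+_])
open import Data.Rational as ℚ using (ℚ; _/_; 0ℚ)

-- All binary words (lists of booleans; false = 0, true = 1) of length N.
allWords : ℕ → List (List Bool)
allWords zero    = [] ∷ []
allWords (suc N) = map (false ∷_) (allWords N) ++ map (true ∷_) (allWords N)

zeros : List Bool → ℕ
zeros []           = 0
zeros (false ∷ w) = suc (zeros w)
zeros (true ∷ w)  = zeros w

count000 : List Bool → ℕ
count000 (false ∷ false ∷ false ∷ w) = suc (count000 (false ∷ false ∷ w))
count000 (_ ∷ w)                       = count000 w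
count000 []                            = 0

-- cyclic occurrences of 000 in a word S of length N ≥ 3:
-- positions i ∈ {1..N} with S_i S_{i+1} S_{i+2} = 000, indices mod N.
-- Equivalently linear occurrences in S ++ (first two letters of S).
cyc000 : List Bool → ℕ
cyc000 w = count000 (w ++ take 2 w)

T000 : ℕ → ℕ → ℕ → ℕ
T000 m n g = length (filter (λ w → zeros w ℕ≟ m ×-dec cyc000 w ℕ≟ g) (allWords (m + n)))
  where
  open import Data.Nat using () renaming (_≟_ to _ℕ≟_)
  open import Relation.Nullary.Decidable using (_×-dec_)

binomZ : ℕ → ℤ → ℕ
binomZ a (+ b)    = a C b
binomZ a -[1+ _ ] = 0

-- a / b as a rational (b = 0 gives 0; only used with b ≥ 1)
frac : ℕ → ℕ → ℚ
frac a zero    = 0ℚ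
frac a (suc b) = + a / suc b

sum1 : ℕ → (ℕ → ℚ) → ℚ
sum1 zero    f = 0ℚ
sum1 (suc k) f = sum1 k f ℚ.+ f (suc k)

sum0ℕ : ℕ → (ℕ → ℕ) → ℕ
sum0ℕ zero    f = f 0
sum0ℕ (suc k) f = sum0ℕ k f + f (suc k)

-- c'^{mg}_h = (1/g) Σ_{ℓ≥0} ℓ C(h,ℓ) C(g,ℓ) C(h-ℓ, m-g-h-ℓ)  (g ≠ 0),
-- c'^{m0}_h = C(h, m-h).  Terms with ℓ > h vanish since C(h,ℓ)=0.
cPrime : ℕ → ℕ → ℕ → ℚ
cPrime m zero h = frac (binomZ h (+ m ℤ.- + h)) 1
cPrime m (suc g') h =
  frac (sum0ℕ h (λ ℓ → ℓ * (h C ℓ) * (suc g' C ℓ)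
                       * binomZ (h ∸ ℓ) (+ m ℤ.- + suc g' ℤ.- + h ℤ.- + ℓ)))
       (suc g')

module Submission where

-- Rotation permutes the cyclic occurrences of 000, so counting the ones over all N rotations of
-- each word gives n·T = N·L, where L counts the linear words of length N − 1 with m zeros and g
-- occurrences of 000 (cut a cyclic word just after a one).  Such a word followed by a one splits
-- into n blocks "run of zeros, then a one"; with x marking zeros and y occurrences of 000 a run
-- has series 1 + A, A = x + x²/(1 − xy), so L is the coefficient of xᵐyᵍ in (1 + A)ⁿ
-- = Σₕ C(n,h) Aʰ.  The coefficient of xᵐyᵍ in Aʰ counts compositions of m into h parts of total
-- excess g, namely C(h,L)·C(L+g−1,g) with L = m − h − g parts of size ≥ 2; trinomial revision,
-- absorption and Vandermonde's identity turn the paper's sum for c′ into this closed form.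
-- Finally (N/h)·C(n−1,h−1) = (N/n)·C(n,h).

module Counting where

  open import Data.Bool using (Bool; true; false; if_then_else_)
  open import Data.Empty using (⊥-elim)
  open import Data.Integer as ℤ using (_⊖_)
  import Data.Integer.Properties as ℤP
  open import Data.List using (List; []; _∷_; _++_; _∷ʳ_; map; take; length; filter)
  open import Data.List.Properties using (++-assoc; ++-identityʳ; length-++; filter-++)
  open import Data.Nat using (ℕ; zero; suc; _+_; _*_; _∸_; _≤_; _<_; z≤n; s≤s; _<?_; _≤?_; _⊓_)
  open import Data.Nat.Combinatorics using (_C_; nC1≡n; k>n⇒nCk≡0; nCk+nC[k+1]≡[n+1]C[k+1])
  open import Data.Nat.GeneralisedArithmetic using (iterate)
  open import Data.Nat.Properties
  open import Data.Nat.Solver using (module +-*-Solver)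
  open import Algebra.Properties.CommutativeSemigroup +-commutativeSemigroup using (interchange; x∙yz≈y∙xz)
  open import Data.Product using (_×_; _,_)
  open import Data.Sum using (inj₁; inj₂)
  open import Function using (_∘_)
  open import Level using (Level)
  open import Relation.Nullary using (Dec; does; yes; no; ¬_)
  open import Relation.Nullary.Decidable using (_×-dec_)
  open import Relation.Unary using (Pred; Decidable)
  open import Relation.Binary.PropositionalEquality
  open ≡-Reasoning
  open +-*-Solver using (solve; _:=_; _:+_; _:*_; con)
  open import Defs

  private
    variable
      ℓ ℓ′ : Level
      A B : Set ℓ

  sum0ℕ-cong : ∀ k {f g : ℕ → ℕ} → (∀ i → f i ≡ g i) → sum0ℕ k f ≡ sum0ℕ k g
  sum0ℕ-cong zero    f≗g = f≗g 0
  sum0ℕ-cong (suc k) f≗g = cong₂ _+_ (sum0ℕ-cong k f≗g) (f≗g (suc k))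

  sum0ℕ-unfoldˡ : ∀ k f → sum0ℕ (suc k) f ≡ f 0 + sum0ℕ k (f ∘ suc)
  sum0ℕ-unfoldˡ zero    f = refl
  sum0ℕ-unfoldˡ (suc k) f = trans (cong (_+ f (suc (suc k))) (sum0ℕ-unfoldˡ k f)) (+-assoc (f 0) _ _)

  sum0ℕ-+ : ∀ k f g → sum0ℕ k (λ i → f i + g i) ≡ sum0ℕ k f + sum0ℕ k g
  sum0ℕ-+ zero    f g = refl
  sum0ℕ-+ (suc k) f g =
    trans (cong (_+ (f (suc k) + g (suc k))) (sum0ℕ-+ k f g))
          (interchange (sum0ℕ k f) (sum0ℕ k g) (f (suc k)) (g (suc k)))

  sum0ℕ-*ˡ : ∀ k c f → sum0ℕ k (λ i → c * f i) ≡ c * sum0ℕ k f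
  sum0ℕ-*ˡ zero    c f = refl
  sum0ℕ-*ˡ (suc k) c f = trans (cong (_+ c * f (suc k)) (sum0ℕ-*ˡ k c f)) (sym (*-distribˡ-+ c _ _))

  sum0ℕ-*ʳ : ∀ k f c → sum0ℕ k f * c ≡ sum0ℕ k (λ i → f i * c)
  sum0ℕ-*ʳ zero    f c = refl
  sum0ℕ-*ʳ (suc k) f c = trans (*-distribʳ-+ c (sum0ℕ k f) _) (cong (_+ f (suc k) * c) (sum0ℕ-*ʳ k f c))

  sum0ℕ-const : ∀ k c → sum0ℕ k (λ _ → c) ≡ suc k * c
  sum0ℕ-const zero    c = sym (*-identityˡ c)
  sum0ℕ-const (suc k) c = trans (cong (_+ c) (sum0ℕ-const k c)) (+-comm (suc k * c) c)

  sum0ℕ-vanishing : ∀ L d t → (∀ l → L < l → t l ≡ 0) → sum0ℕ (L + d) t ≡ sum0ℕ L t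
  sum0ℕ-vanishing L zero    t t≡0 = cong (λ k → sum0ℕ k t) (+-identityʳ L)
  sum0ℕ-vanishing L (suc d) t t≡0 rewrite +-suc L d =
    trans (cong₂ _+_ (sum0ℕ-vanishing L d t t≡0) (t≡0 (suc (L + d)) (s≤s (m≤m+n L d)))) (+-identityʳ _)

  sum0ℕ-⊓ : ∀ m n f → (∀ h → m < h → f h ≡ 0) → sum0ℕ (m ⊓ n) f ≡ sum0ℕ n f
  sum0ℕ-⊓ m n f beyond with ≤-total m n
  ... | inj₁ m≤n = begin
    sum0ℕ (m ⊓ n) f          ≡⟨ cong (λ k → sum0ℕ k f) (m≤n⇒m⊓n≡m m≤n) ⟩
    sum0ℕ m f                ≡⟨ sym (sum0ℕ-vanishing m (n ∸ m) f beyond) ⟩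
    sum0ℕ (m + (n ∸ m)) f    ≡⟨ cong (λ k → sum0ℕ k f) (m+[n∸m]≡n m≤n) ⟩
    sum0ℕ n f                ∎
  ... | inj₂ n≤m = cong (λ k → sum0ℕ k f) (m≥n⇒m⊓n≡n n≤m)

  C-pascal : ∀ n k → suc n C suc k ≡ n C k + n C suc k
  C-pascal n k = sym (nCk+nC[k+1]≡[n+1]C[k+1] n k)

  pascal-sum : ∀ k (a : ℕ → ℕ) →
    sum0ℕ (suc k) (λ h → (suc k C h) * a h) ≡ sum0ℕ k (λ h → (k C h) * a h) + sum0ℕ k (λ h → (k C h) * a (suc h))
  pascal-sum k a = begin
    sum0ℕ (suc k) (λ h → (suc k C h) * a h)
      ≡⟨ sum0ℕ-unfoldˡ k _ ⟩
    1 * a 0 + sum0ℕ k (λ h → (suc k C suc h) * a (suc h))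
      ≡⟨ cong (1 * a 0 +_) (trans (sum0ℕ-cong k (λ h → trans (cong (_* a (suc h)) (C-pascal k h))
                                                                (*-distribʳ-+ (a (suc h)) (k C h) _)))
                                   (sum0ℕ-+ k _ _)) ⟩
    1 * a 0 + (sum0ℕ k (λ h → (k C h) * a (suc h)) + sum0ℕ k (λ h → (k C suc h) * a (suc h)))
      ≡⟨ cong (1 * a 0 +_) (+-comm (sum0ℕ k (λ h → (k C h) * a (suc h))) _) ⟩
    1 * a 0 + (sum0ℕ k (λ h → (k C suc h) * a (suc h)) + sum0ℕ k (λ h → (k C h) * a (suc h)))
      ≡⟨ sym (+-assoc (1 * a 0) _ _) ⟩
    1 * a 0 + sum0ℕ k (λ h → (k C suc h) * a (suc h)) + sum0ℕ k (λ h → (k C h) * a (suc h))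
      ≡⟨ cong (_+ sum0ℕ k (λ h → (k C h) * a (suc h))) (sym (sum0ℕ-unfoldˡ k (λ h → (k C h) * a h))) ⟩
    sum0ℕ (suc k) (λ h → (k C h) * a h) + sum0ℕ k (λ h → (k C h) * a (suc h))
      ≡⟨ cong (λ c → sum0ℕ k (λ h → (k C h) * a h) + c * a (suc k) + sum0ℕ k (λ h → (k C h) * a (suc h)))
              (k>n⇒nCk≡0 (n<1+n k)) ⟩
    sum0ℕ k (λ h → (k C h) * a h) + 0 + sum0ℕ k (λ h → (k C h) * a (suc h))
      ≡⟨ cong (_+ sum0ℕ k (λ h → (k C h) * a (suc h))) (+-identityʳ _) ⟩
    sum0ℕ k (λ h → (k C h) * a h) + sum0ℕ k (λ h → (k C h) * a (suc h)) ∎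

  C-absorption : ∀ n k → suc k * (suc n C suc k) ≡ suc n * (n C k)
  C-absorption zero    zero    = refl
  C-absorption zero    (suc k) = *-zeroʳ (suc (suc k))
  C-absorption (suc n) zero    = trans (*-identityˡ _) (trans (nC1≡n (suc (suc n))) (sym (*-identityʳ _)))
  C-absorption (suc n) (suc k) = begin
    suc (suc k) * (suc (suc n) C suc (suc k))
      ≡⟨ cong (suc (suc k) *_) (C-pascal (suc n) (suc k)) ⟩
    suc (suc k) * (p + q)
      ≡⟨ solve 3 (λ K P Q → (con 2 :+ K) :* (P :+ Q) := (con 1 :+ K) :* P :+ P :+ (con 2 :+ K) :* Q) refl k p q ⟩
    suc k * p + p + suc (suc k) * q
      ≡⟨ cong₂ (λ x y → x + p + y) (C-absorption n k) (C-absorption n (suc k)) ⟩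
    suc n * u + p + suc n * v
      ≡⟨ solve 4 (λ N U V P → (con 1 :+ N) :* U :+ P :+ (con 1 :+ N) :* V := (con 1 :+ N) :* (U :+ V) :+ P) refl n u v p ⟩
    suc n * (u + v) + p
      ≡⟨ cong (λ x → suc n * x + p) (sym (C-pascal n k)) ⟩
    suc n * p + p
      ≡⟨ solve 2 (λ N P → (con 1 :+ N) :* P :+ P := (con 2 :+ N) :* P) refl n p ⟩
    suc (suc n) * p ∎
    where
    p = suc n C suc k
    q = suc n C suc (suc k)
    u = n C k
    v = n C suc k

  shiftBy : ℕ → (ℕ → ℕ) → ℕ → ℕ
  shiftBy zero    f m       = f m
  shiftBy (suc a) f zero    = 0
  shiftBy (suc a) f (suc m) = shiftBy a f m

  shiftBy-cong : ∀ a {f f′ : ℕ → ℕ} → (∀ L → f L ≡ f′ L) → ∀ m → shiftBy a f m ≡ shiftBy a f′ m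
  shiftBy-cong zero    f≗f′ m       = f≗f′ m
  shiftBy-cong (suc a) f≗f′ zero    = refl
  shiftBy-cong (suc a) f≗f′ (suc m) = shiftBy-cong a f≗f′ m

  shiftBy-+ : ∀ a f f′ m → shiftBy a f m + shiftBy a f′ m ≡ shiftBy a (λ L → f L + f′ L) m
  shiftBy-+ zero    f f′ m       = refl
  shiftBy-+ (suc a) f f′ zero    = refl
  shiftBy-+ (suc a) f f′ (suc m) = shiftBy-+ a f f′ m

  shiftBy-suc : ∀ a f m → shiftBy a (shiftBy 1 f) m ≡ shiftBy (suc a) f m
  shiftBy-suc zero    f m       = refl
  shiftBy-suc (suc a) f zero    = refl
  shiftBy-suc (suc a) f (suc m) = shiftBy-suc a f m

  shiftBy-offset : ∀ a b f L → shiftBy (a + b) f (a + L) ≡ shiftBy b f L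
  shiftBy-offset zero    b f L = refl
  shiftBy-offset (suc a) b f L = shiftBy-offset a b f L

  shiftBy-at : ∀ a f L → shiftBy a f (a + L) ≡ f L
  shiftBy-at zero    f L = refl
  shiftBy-at (suc a) f L = shiftBy-at a f L

  shiftBy-below : ∀ a f m → m < a → shiftBy a f m ≡ 0
  shiftBy-below (suc a) f zero    _         = refl
  shiftBy-below (suc a) f (suc m) (s≤s m<a) = shiftBy-below a f m m<a

  shiftBy-zero : ∀ a m → shiftBy a (λ _ → 0) m ≡ 0
  shiftBy-zero zero    m       = refl
  shiftBy-zero (suc a) zero    = refl
  shiftBy-zero (suc a) (suc m) = shiftBy-zero a m

  C-pascal-shifted : ∀ x t → suc x C t ≡ shiftBy 1 (x C_) t + x C t
  C-pascal-shifted x zero    = refl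
  C-pascal-shifted x (suc t) = C-pascal x t

  C-trinomial : ∀ h l L → (h C l) * shiftBy l ((h ∸ l) C_) L ≡ (h C L) * (L C l)
  C-trinomial h       zero    L       = trans (*-identityˡ (h C L)) (sym (*-identityʳ (h C L)))
  C-trinomial h       (suc l) zero    = *-zeroʳ (h C suc l)
  C-trinomial zero    (suc l) (suc L) = refl
  C-trinomial (suc h) (suc l) (suc L) = begin
    (suc h C suc l) * S
      ≡⟨ cong (_* S) (C-pascal h l) ⟩
    ((h C l) + (h C suc l)) * S
      ≡⟨ *-distribʳ-+ S (h C l) (h C suc l) ⟩
    (h C l) * S + (h C suc l) * S
      ≡⟨ cong₂ _+_ (C-trinomial h l L) (split (l <? h)) ⟩
    (h C L) * (L C l) + ((h C suc l) * shiftBy (suc l) ((h ∸ suc l) C_) L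
                         + (h C suc l) * shiftBy (suc l) ((h ∸ suc l) C_) (suc L))
      ≡⟨ cong ((h C L) * (L C l) +_) (cong₂ _+_ (C-trinomial h (suc l) L) (C-trinomial h (suc l) (suc L))) ⟩
    (h C L) * (L C l) + ((h C L) * (L C suc l) + (h C suc L) * (suc L C suc l))
      ≡⟨ sym (+-assoc ((h C L) * (L C l)) _ _) ⟩
    (h C L) * (L C l) + (h C L) * (L C suc l) + (h C suc L) * (suc L C suc l)
      ≡⟨ cong (_+ (h C suc L) * (suc L C suc l))
              (trans (sym (*-distribˡ-+ (h C L) (L C l) (L C suc l))) (cong ((h C L) *_) (sym (C-pascal L l)))) ⟩
    (h C L) * (suc L C suc l) + (h C suc L) * (suc L C suc l)
      ≡⟨ sym (*-distribʳ-+ (suc L C suc l) (h C L) (h C suc L)) ⟩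
    ((h C L) + (h C suc L)) * (suc L C suc l)
      ≡⟨ cong (_* (suc L C suc l)) (sym (C-pascal h L)) ⟩
    (suc h C suc L) * (suc L C suc l) ∎
    where
    S = shiftBy l ((h ∸ l) C_) L
    split : Dec (l < h) → (h C suc l) * S ≡ (h C suc l) * shiftBy (suc l) ((h ∸ suc l) C_) L
                                           + (h C suc l) * shiftBy (suc l) ((h ∸ suc l) C_) (suc L)
    split (yes l<h) = begin
      (h C suc l) * shiftBy l ((h ∸ l) C_) L
        ≡⟨ cong (λ y → (h C suc l) * shiftBy l (y C_) L) (+-∸-assoc 1 l<h) ⟩
      (h C suc l) * shiftBy l (suc x C_) L
        ≡⟨ cong ((h C suc l) *_) (trans (shiftBy-cong l (C-pascal-shifted x) L)
                                        (sym (shiftBy-+ l (shiftBy 1 (x C_)) (x C_) L))) ⟩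
      (h C suc l) * (shiftBy l (shiftBy 1 (x C_)) L + shiftBy l (x C_) L)
        ≡⟨ cong (λ y → (h C suc l) * (y + shiftBy l (x C_) L)) (shiftBy-suc l (x C_) L) ⟩
      (h C suc l) * (shiftBy (suc l) (x C_) L + shiftBy (suc l) (x C_) (suc L))
        ≡⟨ *-distribˡ-+ (h C suc l) _ _ ⟩
      (h C suc l) * shiftBy (suc l) (x C_) L + (h C suc l) * shiftBy (suc l) (x C_) (suc L) ∎
      where x = h ∸ suc l
    split (no l≮h) = trans (cong (_* S) hC≡0)
      (sym (cong₂ _+_ (cong (_* shiftBy (suc l) ((h ∸ suc l) C_) L) hC≡0)
                      (cong (_* shiftBy (suc l) ((h ∸ suc l) C_) (suc L)) hC≡0)))
      where
      hC≡0 : h C suc l ≡ 0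
      hC≡0 = k>n⇒nCk≡0 (s≤s (≮⇒≥ l≮h))

  vandermonde : ∀ a L r R → a ≤ R → sum0ℕ R (λ j → (L C (r + j)) * (a C j)) ≡ (L + a) C (r + a)
  vandermonde zero L r R _ = begin
    sum0ℕ R (λ j → (L C (r + j)) * (0 C j))
      ≡⟨ sum0ℕ-vanishing 0 R _ beyond ⟩
    (L C (r + 0)) * 1
      ≡⟨ *-identityʳ _ ⟩
    L C (r + 0)
      ≡⟨ cong (_C (r + 0)) (sym (+-identityʳ L)) ⟩
    (L + 0) C (r + 0) ∎
    where
    beyond : ∀ j → 0 < j → (L C (r + j)) * (0 C j) ≡ 0
    beyond (suc j) _ = *-zeroʳ (L C (r + suc j))
  vandermonde (suc a) L r (suc R) (s≤s a≤R) = begin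
    sum0ℕ (suc R) (λ j → (L C (r + j)) * (suc a C j))
      ≡⟨ sum0ℕ-unfoldˡ R _ ⟩
    t₀ + sum0ℕ R (λ j → (L C (r + suc j)) * (suc a C suc j))
      ≡⟨ cong (t₀ +_) (trans (sum0ℕ-cong R (λ j → trans (cong ((L C (r + suc j)) *_) (C-pascal a j))
                                                         (*-distribˡ-+ (L C (r + suc j)) (a C j) _)))
                             (sum0ℕ-+ R _ _)) ⟩
    t₀ + (sum0ℕ R (λ j → (L C (r + suc j)) * (a C j)) + sum0ℕ R (λ j → (L C (r + suc j)) * (a C suc j)))
      ≡⟨ x∙yz≈y∙xz t₀ (sum0ℕ R (λ j → (L C (r + suc j)) * (a C j))) _ ⟩
    sum0ℕ R (λ j → (L C (r + suc j)) * (a C j)) + (t₀ + sum0ℕ R (λ j → (L C (r + suc j)) * (a C suc j)))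
      ≡⟨ cong₂ _+_ (trans (sum0ℕ-cong R (λ j → cong (λ i → (L C i) * (a C j)) (+-suc r j)))
                          (vandermonde a L (suc r) R a≤R))
                   (trans (sym (sum0ℕ-unfoldˡ R (λ j → (L C (r + j)) * (a C j))))
                          (vandermonde a L r (suc R) (m≤n⇒m≤1+n a≤R))) ⟩
    (L + a) C suc (r + a) + (L + a) C (r + a)
      ≡⟨ trans (+-comm ((L + a) C suc (r + a)) _) (sym (C-pascal (L + a) (r + a))) ⟩
    suc (L + a) C suc (r + a)
      ≡⟨ sym (cong₂ _C_ (+-suc L a) (+-suc r a)) ⟩
    (L + suc a) C (r + suc a) ∎
    where
    t₀ = (L C (r + 0)) * 1

  sum-ℓ-C-C : ∀ g L h → L ≤ h → sum0ℕ h (λ ℓ → ℓ * (L C ℓ) * (suc g C ℓ)) ≡ suc g * ((L + g) C suc g)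
  sum-ℓ-C-C g L h L≤h = begin
    sum0ℕ h t
      ≡⟨ cong (λ k → sum0ℕ k t) (sym (m+[n∸m]≡n L≤h)) ⟩
    sum0ℕ (L + (h ∸ L)) t
      ≡⟨ sum0ℕ-vanishing L (h ∸ L) t beyond ⟩
    sum0ℕ L t
      ≡⟨ sym (sum0ℕ-vanishing L (suc g) t beyond) ⟩
    sum0ℕ (L + suc g) t
      ≡⟨ cong (λ k → sum0ℕ k t) (+-suc L g) ⟩
    sum0ℕ (suc (L + g)) t
      ≡⟨ sum0ℕ-unfoldˡ (L + g) t ⟩
    sum0ℕ (L + g) (λ j → suc j * (L C suc j) * (suc g C suc j))
      ≡⟨ sum0ℕ-cong (L + g) absorb ⟩
    sum0ℕ (L + g) (λ j → suc g * ((L C (1 + j)) * (g C j)))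
      ≡⟨ sum0ℕ-*ˡ (L + g) (suc g) _ ⟩
    suc g * sum0ℕ (L + g) (λ j → (L C (1 + j)) * (g C j))
      ≡⟨ cong (suc g *_) (vandermonde g L 1 (L + g) (m≤n+m g L)) ⟩
    suc g * ((L + g) C suc g) ∎
    where
    t : ℕ → ℕ
    t ℓ = ℓ * (L C ℓ) * (suc g C ℓ)
    beyond : ∀ ℓ → L < ℓ → t ℓ ≡ 0
    beyond ℓ L<ℓ = trans (cong (λ c → ℓ * c * (suc g C ℓ)) (k>n⇒nCk≡0 L<ℓ)) (cong (_* (suc g C ℓ)) (*-zeroʳ ℓ))
    absorb : ∀ j → suc j * (L C suc j) * (suc g C suc j) ≡ suc g * ((L C (1 + j)) * (g C j))
    absorb j = begin
      suc j * (L C suc j) * (suc g C suc j)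
        ≡⟨ solve 3 (λ J X Y → J :* X :* Y := X :* (J :* Y)) refl (suc j) (L C suc j) (suc g C suc j) ⟩
      (L C suc j) * (suc j * (suc g C suc j))
        ≡⟨ cong ((L C suc j) *_) (C-absorption g j) ⟩
      (L C suc j) * (suc g * (g C j))
        ≡⟨ solve 3 (λ X G Y → X :* (G :* Y) := G :* (X :* Y)) refl (L C suc j) (suc g) (g C j) ⟩
      suc g * ((L C suc j) * (g C j)) ∎

  𝟙 : {P : Set ℓ} → Dec P → ℕ
  𝟙 P? = if does P? then 1 else 0

  𝟙-×-dec-noˡ : {P : Set ℓ} {Q : Set ℓ′} (P? : Dec P) (Q? : Dec Q) → ¬ P → 𝟙 (P? ×-dec Q?) ≡ 0
  𝟙-×-dec-noˡ (yes p) _ ¬p = ⊥-elim (¬p p)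
  𝟙-×-dec-noˡ (no _)  _ _  = refl

  𝟙-×-dec-noʳ : {P : Set ℓ} {Q : Set ℓ′} (P? : Dec P) (Q? : Dec Q) → ¬ Q → 𝟙 (P? ×-dec Q?) ≡ 0
  𝟙-×-dec-noʳ (no _)  _       _  = refl
  𝟙-×-dec-noʳ (yes _) (no _)  _  = refl
  𝟙-×-dec-noʳ (yes _) (yes q) ¬q = ⊥-elim (¬q q)

  sumWords : ℕ → (List Bool → ℕ) → ℕ
  sumWords zero    f = f []
  sumWords (suc N) f = sumWords N (f ∘ (false ∷_)) + sumWords N (f ∘ (true ∷_))

  length-filter-map : {P : Pred B ℓ} (P? : Decidable P) (f : A → B) (xs : List A) →
                      length (filter P? (map f xs)) ≡ length (filter (P? ∘ f) xs)
  length-filter-map P? f []       = refl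
  length-filter-map P? f (x ∷ xs) with does (P? (f x))
  ... | true  = cong suc (length-filter-map P? f xs)
  ... | false = length-filter-map P? f xs

  length-filter-allWords : ∀ N {P : Pred (List Bool) ℓ} (P? : Decidable P) →
                           length (filter P? (allWords N)) ≡ sumWords N (𝟙 ∘ P?)
  length-filter-allWords zero P? with does (P? [])
  ... | true  = refl
  ... | false = refl
  length-filter-allWords (suc N) P? = begin
    length (filter P? (map (false ∷_) ws ++ map (true ∷_) ws))
      ≡⟨ cong length (filter-++ P? (map (false ∷_) ws) _) ⟩
    length (filter P? (map (false ∷_) ws) ++ filter P? (map (true ∷_) ws))
      ≡⟨ length-++ (filter P? (map (false ∷_) ws)) ⟩
    length (filter P? (map (false ∷_) ws)) + length (filter P? (map (true ∷_) ws))
      ≡⟨ cong₂ _+_ (trans (length-filter-map P? _ ws) (length-filter-allWords N _))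
                   (trans (length-filter-map P? _ ws) (length-filter-allWords N _)) ⟩
    sumWords (suc N) (𝟙 ∘ P?) ∎
    where ws = allWords N

  sumWords-cong : ∀ N {f g : List Bool → ℕ} → (∀ w → length w ≡ N → f w ≡ g w) → sumWords N f ≡ sumWords N g
  sumWords-cong zero    f≗g = f≗g [] refl
  sumWords-cong (suc N) f≗g =
    cong₂ _+_ (sumWords-cong N (λ w len → f≗g (false ∷ w) (cong suc len)))
              (sumWords-cong N (λ w len → f≗g (true ∷ w) (cong suc len)))

  sumWords-+ : ∀ N f g → sumWords N (λ w → f w + g w) ≡ sumWords N f + sumWords N g
  sumWords-+ zero    f g = refl
  sumWords-+ (suc N) f g =
    trans (cong₂ _+_ (sumWords-+ N (f ∘ (false ∷_)) (g ∘ (false ∷_))) (sumWords-+ N (f ∘ (true ∷_)) (g ∘ (true ∷_))))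
          (interchange (sumWords N (f ∘ (false ∷_))) (sumWords N (g ∘ (false ∷_))) _ _)

  sumWords-*ˡ : ∀ N c f → sumWords N (λ w → c * f w) ≡ c * sumWords N f
  sumWords-*ˡ zero    c f = refl
  sumWords-*ˡ (suc N) c f =
    trans (cong₂ _+_ (sumWords-*ˡ N c (f ∘ (false ∷_))) (sumWords-*ˡ N c (f ∘ (true ∷_))))
          (sym (*-distribˡ-+ c _ _))

  sumWords-zero : ∀ N → sumWords N (λ _ → 0) ≡ 0
  sumWords-zero zero    = refl
  sumWords-zero (suc N) = cong₂ _+_ (sumWords-zero N) (sumWords-zero N)

  sumWords-sum0ℕ : ∀ N k (F : ℕ → List Bool → ℕ) →
                   sumWords N (λ w → sum0ℕ k (λ i → F i w)) ≡ sum0ℕ k (λ i → sumWords N (F i))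
  sumWords-sum0ℕ N zero    F = refl
  sumWords-sum0ℕ N (suc k) F =
    trans (sumWords-+ N _ (F (suc k))) (cong (_+ sumWords N (F (suc k))) (sumWords-sum0ℕ N k F))

  sumWords-∷ʳ : ∀ N f → sumWords (suc N) f ≡ sumWords N (λ w → f (w ∷ʳ false) + f (w ∷ʳ true))
  sumWords-∷ʳ zero    f = refl
  sumWords-∷ʳ (suc N) f = cong₂ _+_ (sumWords-∷ʳ N (f ∘ (false ∷_))) (sumWords-∷ʳ N (f ∘ (true ∷_)))

  zeros-++ : ∀ u v → zeros (u ++ v) ≡ zeros u + zeros v
  zeros-++ []          v = refl
  zeros-++ (true ∷ u)  v = zeros-++ u v
  zeros-++ (false ∷ u) v = cong suc (zeros-++ u v)

  zeros≤length : ∀ w → zeros w ≤ length w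
  zeros≤length []          = z≤n
  zeros≤length (true ∷ w)  = m≤n⇒m≤1+n (zeros≤length w)
  zeros≤length (false ∷ w) = s≤s (zeros≤length w)

  ones : List Bool → ℕ
  ones []          = 0
  ones (true ∷ w)  = suc (ones w)
  ones (false ∷ w) = ones w

  ones+zeros : ∀ w → ones w + zeros w ≡ length w
  ones+zeros []          = refl
  ones+zeros (true ∷ w)  = cong suc (ones+zeros w)
  ones+zeros (false ∷ w) = trans (+-suc (ones w) (zeros w)) (cong suc (ones+zeros w))

  triple000 : Bool → Bool → Bool → ℕ
  triple000 false false false = 1
  triple000 _     _     _     = 0

  lead000 : Bool → List Bool → ℕ
  lead000 x (y ∷ z ∷ _) = triple000 x y z
  lead000 x _           = 0

  count000-∷ : ∀ x s → count000 (x ∷ s) ≡ lead000 x s + count000 s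
  count000-∷ true  []                  = refl
  count000-∷ true  (y ∷ [])            = refl
  count000-∷ true  (y ∷ z ∷ s)         = refl
  count000-∷ false []                  = refl
  count000-∷ false (true ∷ [])         = refl
  count000-∷ false (false ∷ [])        = refl
  count000-∷ false (true ∷ z ∷ s)      = refl
  count000-∷ false (false ∷ true ∷ s)  = refl
  count000-∷ false (false ∷ false ∷ s) = refl

  lead000-∷ʳ : ∀ x l a b c → lead000 x (l ++ a ∷ b ∷ c ∷ []) ≡ lead000 x (l ++ a ∷ b ∷ [])
  lead000-∷ʳ x []          a b c = refl
  lead000-∷ʳ x (y ∷ [])    a b c = refl
  lead000-∷ʳ x (y ∷ z ∷ l) a b c = refl

  count000-∷ʳ : ∀ l a b c → count000 (l ++ a ∷ b ∷ c ∷ []) ≡ count000 (l ++ a ∷ b ∷ []) + triple000 a b c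
  count000-∷ʳ [] a b c = begin
    count000 (a ∷ b ∷ c ∷ [])                 ≡⟨ count000-∷ a (b ∷ c ∷ []) ⟩
    triple000 a b c + count000 (b ∷ c ∷ [])
      ≡⟨ cong (triple000 a b c +_) (trans (count000-∷ b (c ∷ [])) (count000-∷ c [])) ⟩
    triple000 a b c + 0                        ≡⟨ +-comm (triple000 a b c) 0 ⟩
    0 + triple000 a b c
      ≡⟨ cong (_+ triple000 a b c) (sym (trans (count000-∷ a (b ∷ [])) (count000-∷ b []))) ⟩
    count000 (a ∷ b ∷ []) + triple000 a b c    ∎
  count000-∷ʳ (x ∷ l) a b c = begin
    count000 (x ∷ l ++ a ∷ b ∷ c ∷ [])
      ≡⟨ count000-∷ x (l ++ a ∷ b ∷ c ∷ []) ⟩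
    lead000 x (l ++ a ∷ b ∷ c ∷ []) + count000 (l ++ a ∷ b ∷ c ∷ [])
      ≡⟨ cong₂ _+_ (lead000-∷ʳ x l a b c) (count000-∷ʳ l a b c) ⟩
    lead000 x (l ++ a ∷ b ∷ []) + (count000 (l ++ a ∷ b ∷ []) + triple000 a b c)
      ≡⟨ sym (+-assoc (lead000 x (l ++ a ∷ b ∷ [])) _ _) ⟩
    lead000 x (l ++ a ∷ b ∷ []) + count000 (l ++ a ∷ b ∷ []) + triple000 a b c
      ≡⟨ cong (_+ triple000 a b c) (sym (count000-∷ x (l ++ a ∷ b ∷ []))) ⟩
    count000 (x ∷ l ++ a ∷ b ∷ []) + triple000 a b c ∎

  count000-++-true : ∀ l r → count000 (l ++ true ∷ r) ≡ count000 l + count000 r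
  count000-++-true []                      r = refl
  count000-++-true (true ∷ l)              r = count000-++-true l r
  count000-++-true (false ∷ [])            r = refl
  count000-++-true (false ∷ true ∷ l)      r = count000-++-true l r
  count000-++-true (false ∷ false ∷ [])    r = refl
  count000-++-true (false ∷ false ∷ true ∷ l)  r = count000-++-true l r
  count000-++-true (false ∷ false ∷ false ∷ l) r = cong suc (count000-++-true (false ∷ false ∷ l) r)

  cyc000-true∷ : ∀ v → cyc000 (true ∷ v) ≡ count000 v
  cyc000-true∷ v = trans (count000-++-true v (take 1 v)) (trans (cong (count000 v +_) (short v)) (+-identityʳ _))
    where
    short : ∀ v → count000 (take 1 v) ≡ 0
    short []      = refl
    short (x ∷ v) = count000-∷ x []

  -- Rotations

  rotate : List A → List A
  rotate []      = []
  rotate (x ∷ w) = w ∷ʳ x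

  length-rotate : (w : List A) → length (rotate w) ≡ length w
  length-rotate []      = refl
  length-rotate (x ∷ w) = trans (length-++ w) (+-comm (length w) 1)

  zeros-rotate : ∀ w → zeros (rotate w) ≡ zeros w
  zeros-rotate []      = refl
  zeros-rotate (x ∷ w) = trans (zeros-++ w (x ∷ [])) (trans (+-comm (zeros w) _) (sym (zeros-++ (x ∷ []) w)))

  cyc000-rotate : ∀ w → 3 ≤ length w → cyc000 (rotate w) ≡ cyc000 w
  cyc000-rotate (_ ∷ [])        (s≤s ())
  cyc000-rotate (_ ∷ _ ∷ [])    (s≤s (s≤s ()))
  cyc000-rotate (a ∷ b ∷ c ∷ r) _ = begin
    count000 ((b ∷ c ∷ r) ∷ʳ a ++ b ∷ c ∷ [])
      ≡⟨ cong count000 (++-assoc (b ∷ c ∷ r) (a ∷ []) (b ∷ c ∷ [])) ⟩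
    count000 ((b ∷ c ∷ r) ++ a ∷ b ∷ c ∷ [])
      ≡⟨ count000-∷ʳ (b ∷ c ∷ r) a b c ⟩
    count000 ((b ∷ c ∷ r) ++ a ∷ b ∷ []) + triple000 a b c
      ≡⟨ +-comm _ (triple000 a b c) ⟩
    triple000 a b c + count000 (b ∷ c ∷ r ++ a ∷ b ∷ [])
      ≡⟨ sym (count000-∷ a (b ∷ c ∷ r ++ a ∷ b ∷ [])) ⟩
    count000 (a ∷ b ∷ c ∷ r ++ a ∷ b ∷ []) ∎

  sumWords-rotate : ∀ N f → sumWords N (f ∘ rotate) ≡ sumWords N f
  sumWords-rotate zero    f = refl
  sumWords-rotate (suc N) f =
    trans (sym (sumWords-+ N (λ w → f (w ∷ʳ false)) (λ w → f (w ∷ʳ true)))) (sym (sumWords-∷ʳ N f))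

  sumWords-rotate^ : ∀ N i f → sumWords N (λ w → f (iterate rotate w i)) ≡ sumWords N f
  sumWords-rotate^ N zero    f = refl
  sumWords-rotate^ N (suc i) f = trans (sumWords-rotate N (λ w → f (iterate rotate w i))) (sumWords-rotate^ N i f)

  isOne : List Bool → ℕ
  isOne (true ∷ _) = 1
  isOne _          = 0

  isOne+ones : ∀ x s t → isOne (x ∷ s) + ones t ≡ ones (x ∷ t)
  isOne+ones true  s t = refl
  isOne+ones false s t = refl

  sum-isOne-rotations : ∀ x xs ys →
    sum0ℕ (length xs) (λ i → isOne (iterate rotate ((x ∷ xs) ++ ys) i)) ≡ ones (x ∷ xs)
  sum-isOne-rotations x []       ys = trans (sym (+-identityʳ _)) (isOne+ones x ys [])
  sum-isOne-rotations x (y ∷ xs) ys = begin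
    sum0ℕ (suc (length xs)) (λ i → isOne (iterate rotate (x ∷ y ∷ xs ++ ys) i))
      ≡⟨ sum0ℕ-unfoldˡ (length xs) _ ⟩
    isOne (x ∷ y ∷ xs ++ ys) + sum0ℕ (length xs) (λ i → isOne (iterate rotate ((y ∷ xs ++ ys) ∷ʳ x) i))
      ≡⟨ cong (λ u → isOne (x ∷ y ∷ xs ++ ys) + sum0ℕ (length xs) (λ i → isOne (iterate rotate u i)))
              (++-assoc (y ∷ xs) ys (x ∷ [])) ⟩
    isOne (x ∷ y ∷ xs ++ ys) + sum0ℕ (length xs) (λ i → isOne (iterate rotate ((y ∷ xs) ++ ys ∷ʳ x) i))
      ≡⟨ cong (isOne (x ∷ y ∷ xs ++ ys) +_) (sum-isOne-rotations y xs (ys ∷ʳ x)) ⟩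
    isOne (x ∷ y ∷ xs ++ ys) + ones (y ∷ xs)
      ≡⟨ isOne+ones x _ (y ∷ xs) ⟩
    ones (x ∷ y ∷ xs) ∎

  ones≡sum-isOne-rotations : ∀ K w → length w ≡ suc K → ones w ≡ sum0ℕ K (λ i → isOne (iterate rotate w i))
  ones≡sum-isOne-rotations K (x ∷ xs) len = begin
    ones (x ∷ xs)
      ≡⟨ sym (sum-isOne-rotations x xs []) ⟩
    sum0ℕ (length xs) (λ i → isOne (iterate rotate ((x ∷ xs) ++ []) i))
      ≡⟨ cong₂ (λ k u → sum0ℕ k (λ i → isOne (iterate rotate u i))) (suc-injective len) (++-identityʳ (x ∷ xs)) ⟩
    sum0ℕ K (λ i → isOne (iterate rotate (x ∷ xs) i)) ∎

  rotate^-invariant : ∀ {N} (f : List Bool → ℕ) → (∀ w → length w ≡ N → f (rotate w) ≡ f w) →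
                      ∀ i w → length w ≡ N → f (iterate rotate w i) ≡ f w
  rotate^-invariant f f-rot zero    w len = refl
  rotate^-invariant f f-rot (suc i) w len =
    trans (rotate^-invariant f f-rot i (rotate w) (trans (length-rotate w) len)) (f-rot w len)

  sumWords-ones-* : ∀ K (f : List Bool → ℕ) → (∀ w → length w ≡ suc K → f (rotate w) ≡ f w) →
                    sumWords (suc K) (λ w → ones w * f w) ≡ suc K * sumWords K (λ v → f (true ∷ v))
  sumWords-ones-* K f f-rot = begin
    sumWords N (λ w → ones w * f w)
      ≡⟨ sumWords-cong N (λ w len → trans (cong (_* f w) (ones≡sum-isOne-rotations K w len))
           (trans (sum0ℕ-*ʳ K _ (f w))
                  (sum0ℕ-cong K (λ i → cong (isOne (rot i w) *_) (sym (rotate^-invariant f f-rot i w len)))))) ⟩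
    sumWords N (λ w → sum0ℕ K (λ i → isOne (rot i w) * f (rot i w)))
      ≡⟨ sumWords-sum0ℕ N K (λ i w → isOne (rot i w) * f (rot i w)) ⟩
    sum0ℕ K (λ i → sumWords N (λ w → isOne (rot i w) * f (rot i w)))
      ≡⟨ sum0ℕ-cong K (λ i → sumWords-rotate^ N i (λ w → isOne w * f w)) ⟩
    sum0ℕ K (λ _ → sumWords N (λ w → isOne w * f w))
      ≡⟨ sum0ℕ-const K _ ⟩
    N * (sumWords K (λ _ → 0) + sumWords K (λ v → 1 * f (true ∷ v)))
      ≡⟨ cong (N *_) (cong₂ _+_ (sumWords-zero K) (sumWords-cong K (λ v _ → *-identityˡ (f (true ∷ v))))) ⟩
    N * sumWords K (λ v → f (true ∷ v)) ∎
    where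
    N = suc K
    rot : ℕ → List Bool → List Bool
    rot i w = iterate rotate w i

  profile? : ∀ m g w → Dec (zeros w ≡ m × cyc000 w ≡ g)
  profile? m g w = zeros w ≟ m ×-dec cyc000 w ≟ g

  profile?-rotate : ∀ m g w → 3 ≤ length w → 𝟙 (profile? m g (rotate w)) ≡ 𝟙 (profile? m g w)
  profile?-rotate m g w len =
    cong₂ (λ z c → 𝟙 (z ≟ m ×-dec c ≟ g)) (zeros-rotate w) (cyc000-rotate w len)

  ones≡n-on-profile : ∀ m n g w → length w ≡ m + n → n * 𝟙 (profile? m g w) ≡ ones w * 𝟙 (profile? m g w)
  ones≡n-on-profile m n g w len = weight (profile? m g w)
    where
    weight : (d : Dec (zeros w ≡ m × cyc000 w ≡ g)) → n * 𝟙 d ≡ ones w * 𝟙 d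
    weight (no _)               = trans (*-zeroʳ n) (sym (*-zeroʳ (ones w)))
    weight (yes (zeros≡m , _)) = cong (_* 1) (sym (+-cancelʳ-≡ m (ones w) n (begin
      ones w + m       ≡⟨ cong (ones w +_) (sym zeros≡m) ⟩
      ones w + zeros w ≡⟨ ones+zeros w ⟩
      length w         ≡⟨ len ⟩
      m + n            ≡⟨ +-comm m n ⟩
      n + m            ∎)))

  cyclic-count : ∀ m n g K → m + n ≡ suc K → 2 ≤ K →
    n * T000 m n g ≡ suc K * sumWords K (λ v → 𝟙 (zeros v ≟ m ×-dec count000 v ≟ g))
  cyclic-count m n g K N≡1+K 2≤K = begin
    n * T000 m n g
      ≡⟨ cong (n *_) (trans (length-filter-allWords (m + n) (profile? m g))
                            (cong (λ N → sumWords N (𝟙 ∘ profile? m g)) N≡1+K)) ⟩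
    n * sumWords (suc K) (𝟙 ∘ profile? m g)
      ≡⟨ sym (sumWords-*ˡ (suc K) n (𝟙 ∘ profile? m g)) ⟩
    sumWords (suc K) (λ w → n * 𝟙 (profile? m g w))
      ≡⟨ sumWords-cong (suc K) (λ w len → ones≡n-on-profile m n g w (trans len (sym N≡1+K))) ⟩
    sumWords (suc K) (λ w → ones w * 𝟙 (profile? m g w))
      ≡⟨ sumWords-ones-* K (𝟙 ∘ profile? m g) (λ w len → profile?-rotate m g w (subst (3 ≤_) (sym len) (s≤s 2≤K))) ⟩
    suc K * sumWords K (λ v → 𝟙 (profile? m g (true ∷ v)))
      ≡⟨ cong (suc K *_) (sumWords-cong K (λ v _ → cong (λ c → 𝟙 (zeros v ≟ m ×-dec c ≟ g)) (cyc000-true∷ v))) ⟩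
    suc K * sumWords K (λ v → 𝟙 (zeros v ≟ m ×-dec count000 v ≟ g)) ∎

  -- Generating series of words

  -- F m g is the coefficient of xᵐyᵍ.
  Series : Set
  Series = ℕ → ℕ → ℕ

  infix  4 _≋_
  infixl 6 _⊕_
  infixr 7 x·_ y·_

  _≋_ : Series → Series → Set
  F ≋ G = ∀ m g → F m g ≡ G m g

  _⊕_ : Series → Series → Series
  (F ⊕ G) m g = F m g + G m g

  x·_ : Series → Series
  (x· F) zero    g = 0
  (x· F) (suc m) g = F m g

  y·_ : Series → Series
  (y· F) m zero    = 0
  (y· F) m (suc g) = F m g

  1ₛ : Series
  1ₛ zero zero = 1
  1ₛ _    _    = 0

  geometric : Series → Series
  geometric F (suc m) (suc g) = F (suc m) (suc g) + geometric F m g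
  geometric F m       g       = F m g

  x·-cong : ∀ {F G} → F ≋ G → x· F ≋ x· G
  x·-cong F≋G zero    g = refl
  x·-cong F≋G (suc m) g = F≋G m g

  x·-⊕ : ∀ F G → x· (F ⊕ G) ≋ x· F ⊕ x· G
  x·-⊕ F G zero    g = refl
  x·-⊕ F G (suc m) g = refl

  geometric-cong : ∀ {F G} → F ≋ G → geometric F ≋ geometric G
  geometric-cong F≋G zero    g       = F≋G zero g
  geometric-cong F≋G (suc m) zero    = F≋G (suc m) zero
  geometric-cong F≋G (suc m) (suc g) = cong₂ _+_ (F≋G (suc m) (suc g)) (geometric-cong F≋G m g)

  geometric-⊕ : ∀ F G → geometric (F ⊕ G) ≋ geometric F ⊕ geometric G
  geometric-⊕ F G zero    g       = refl
  geometric-⊕ F G (suc m) zero    = refl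
  geometric-⊕ F G (suc m) (suc g) =
    trans (cong (F (suc m) (suc g) + G (suc m) (suc g) +_) (geometric-⊕ F G m g))
          (interchange (F (suc m) (suc g)) (G (suc m) (suc g)) (geometric F m g) (geometric G m g))

  geometric-unfold : ∀ F → geometric F ≋ F ⊕ x· y· geometric F
  geometric-unfold F zero    g       = sym (+-identityʳ (F zero g))
  geometric-unfold F (suc m) zero    = sym (+-identityʳ (F (suc m) zero))
  geometric-unfold F (suc m) (suc g) = refl

  data Run : Set where
    run0 run1 run2 : Run

  -- Only the last two letters read so far matter for the occurrences of 000 still to come.
  prefix : Run → List Bool
  prefix run0 = []
  prefix run1 = false ∷ []
  prefix run2 = false ∷ false ∷ []

  next : Run → Run
  next run0 = run1
  next run1 = run2
  next run2 = run2

  onZero : Run → Series → Series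
  onZero run2 F = y· F
  onZero _    F = F

  onZero-cong : ∀ s {F G : Series} {m} → (∀ g → F m g ≡ G m g) → ∀ g → onZero s F m g ≡ onZero s G m g
  onZero-cong run0 F≡G g       = F≡G g
  onZero-cong run1 F≡G g       = F≡G g
  onZero-cong run2 F≡G zero    = refl
  onZero-cong run2 F≡G (suc g) = F≡G g

  -- A possibly empty run of zeros read after prefix s, then the words of F; from the third
  -- consecutive zero on, each zero completes an occurrence, hence the factor 1/(1 − xy).
  afterRun : Run → Series → Series
  afterRun run2 F = geometric F
  afterRun run1 F = F ⊕ x· geometric F
  afterRun run0 F = F ⊕ x· afterRun run1 F

  afterRun-unfold : ∀ s F → afterRun s F ≋ F ⊕ x· onZero s (afterRun (next s) F)
  afterRun-unfold run0 F m g = refl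
  afterRun-unfold run1 F m g = refl
  afterRun-unfold run2 F     = geometric-unfold F

  -- The series A of a nonempty run of zeros; afterRun run0 F is F ⊕ zeroBlock F by definition.
  zeroBlock : Series → Series
  zeroBlock F = x· afterRun run1 F

  zeroBlock-cong : ∀ {F G} → F ≋ G → zeroBlock F ≋ zeroBlock G
  zeroBlock-cong F≋G = x·-cong (λ m g → cong₂ _+_ (F≋G m g) (x·-cong (geometric-cong F≋G) m g))

  zeroBlock-⊕ : ∀ F G → zeroBlock (F ⊕ G) ≋ zeroBlock F ⊕ zeroBlock G
  zeroBlock-⊕ F G zero    g = refl
  zeroBlock-⊕ F G (suc m) g =
    trans (cong (F m g + G m g +_) (trans (x·-cong (geometric-⊕ F G) m g) (x·-⊕ (geometric F) (geometric G) m g)))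
          (interchange (F m g) (G m g) _ _)

  iterate-suc : (f : A → A) (x : A) (n : ℕ) → iterate f x (suc n) ≡ f (iterate f x n)
  iterate-suc f x zero    = refl
  iterate-suc f x (suc n) = iterate-suc f (f x) n

  iterate-cong : (A : Series → Series) → (∀ {F G} → F ≋ G → A F ≋ A G) →
                 ∀ h {F G} → F ≋ G → iterate A F h ≋ iterate A G h
  iterate-cong A A-cong zero    F≋G = F≋G
  iterate-cong A A-cong (suc h) F≋G = iterate-cong A A-cong h (A-cong F≋G)

  iterate-⊕ : (A : Series → Series) → (∀ {F G} → F ≋ G → A F ≋ A G) → (∀ F G → A (F ⊕ G) ≋ A F ⊕ A G) →
              ∀ h F G → iterate A (F ⊕ G) h ≋ iterate A F h ⊕ iterate A G h
  iterate-⊕ A A-cong A-⊕ zero    F G m g = refl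
  iterate-⊕ A A-cong A-⊕ (suc h) F G m g =
    trans (iterate-cong A A-cong h (A-⊕ F G) m g) (iterate-⊕ A A-cong A-⊕ h (A F) (A G) m g)

  binomial-expansion : (A : Series → Series) →
    (∀ {F G} → F ≋ G → A F ≋ A G) → (∀ F G → A (F ⊕ G) ≋ A F ⊕ A G) →
    ∀ k F → iterate (λ G → G ⊕ A G) F k ≋ λ m g → sum0ℕ k (λ h → (k C h) * iterate A F h m g)
  binomial-expansion A A-cong A-⊕ zero    F m g = sym (+-identityʳ (F m g))
  binomial-expansion A A-cong A-⊕ (suc k) F m g = begin
    iterate (λ G → G ⊕ A G) (F ⊕ A F) k m g
      ≡⟨ binomial-expansion A A-cong A-⊕ k (F ⊕ A F) m g ⟩
    sum0ℕ k (λ h → (k C h) * iterate A (F ⊕ A F) h m g)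
      ≡⟨ sum0ℕ-cong k (λ h → trans (cong ((k C h) *_) (iterate-⊕ A A-cong A-⊕ h F (A F) m g))
                                    (*-distribˡ-+ (k C h) _ _)) ⟩
    sum0ℕ k (λ h → (k C h) * iterate A F h m g + (k C h) * iterate A F (suc h) m g)
      ≡⟨ sum0ℕ-+ k _ _ ⟩
    sum0ℕ k (λ h → (k C h) * iterate A F h m g) + sum0ℕ k (λ h → (k C h) * iterate A F (suc h) m g)
      ≡⟨ sym (pascal-sum k (λ h → iterate A F h m g)) ⟩
    sum0ℕ (suc k) (λ h → (suc k C h) * iterate A F h m g) ∎

  powerSeries : ℕ → Series
  powerSeries = iterate (afterRun run0) 1ₛ

  wordsAfter : Run → ℕ → Series
  wordsAfter s K m g = sumWords K (λ v → 𝟙 (zeros v ≟ m ×-dec count000 (prefix s ++ v) ≟ g))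

  wordsAfter-vanishing : ∀ s K m g → K < m → wordsAfter s K m g ≡ 0
  wordsAfter-vanishing s K m g K<m = trans (sumWords-cong K {g = λ _ → 0} (λ v len →
      𝟙-×-dec-noˡ (zeros v ≟ m) (count000 (prefix s ++ v) ≟ g)
        (λ zeros≡m → <⇒≱ K<m (subst₂ _≤_ zeros≡m len (zeros≤length v)))))
    (sumWords-zero K)

  wordsAfter-suc : ∀ s K → wordsAfter s (suc K) ≋ x· onZero s (wordsAfter (next s) K) ⊕ wordsAfter run0 K
  wordsAfter-suc s K m g = cong₂ _+_ (leading-zero s m g) (leading-one s)
    where
    leading-one : ∀ s → sumWords K (λ v → 𝟙 (zeros (true ∷ v) ≟ m ×-dec count000 (prefix s ++ true ∷ v) ≟ g))
                      ≡ wordsAfter run0 K m g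
    leading-one run0 = refl
    leading-one run1 = refl
    leading-one run2 = refl
    leading-zero : ∀ s m′ g′ →
      sumWords K (λ v → 𝟙 (zeros (false ∷ v) ≟ m′ ×-dec count000 (prefix s ++ false ∷ v) ≟ g′))
        ≡ (x· onZero s (wordsAfter (next s) K)) m′ g′
    leading-zero s    zero     g′       = sumWords-zero K
    leading-zero run0 (suc m′) g′       = refl
    leading-zero run1 (suc m′) g′       = refl
    leading-zero run2 (suc m′) zero     =
      trans (sumWords-cong K {g = λ _ → 0} (λ v _ →
               𝟙-×-dec-noʳ (suc (zeros v) ≟ suc m′) (count000 (false ∷ false ∷ false ∷ v) ≟ 0) (λ ())))
            (sumWords-zero K)
    leading-zero run2 (suc m′) (suc g′) = refl

  wordsAfter≡afterRun : ∀ K s k m g → k + m ≡ K → wordsAfter s K m g ≡ afterRun s (powerSeries k) m g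
  wordsAfter≡afterRun zero    s zero    zero    g refl = empty-word s g
    where
    empty-word : ∀ s g → wordsAfter s 0 0 g ≡ afterRun s 1ₛ 0 g
    empty-word run0 zero    = refl
    empty-word run1 zero    = refl
    empty-word run2 zero    = refl
    empty-word run0 (suc g) = refl
    empty-word run1 (suc g) = refl
    empty-word run2 (suc g) = refl
  wordsAfter≡afterRun zero    s zero    (suc m) g ()
  wordsAfter≡afterRun zero    s (suc k) m       g ()
  wordsAfter≡afterRun (suc K) s k       m       g k+m≡1+K = begin
    wordsAfter s (suc K) m g
      ≡⟨ wordsAfter-suc s K m g ⟩
    (x· onZero s (wordsAfter (next s) K)) m g + wordsAfter run0 K m g
      ≡⟨ cong₂ _+_ (leading-zeros m k+m≡1+K) (leading-ones k k+m≡1+K) ⟩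
    (x· onZero s (afterRun (next s) (powerSeries k))) m g + powerSeries k m g
      ≡⟨ +-comm _ (powerSeries k m g) ⟩
    powerSeries k m g + (x· onZero s (afterRun (next s) (powerSeries k))) m g
      ≡⟨ sym (afterRun-unfold s (powerSeries k) m g) ⟩
    afterRun s (powerSeries k) m g ∎
    where
    leading-zeros : ∀ m → k + m ≡ suc K →
      (x· onZero s (wordsAfter (next s) K)) m g ≡ (x· onZero s (afterRun (next s) (powerSeries k))) m g
    leading-zeros zero    _  = refl
    leading-zeros (suc m) eq = onZero-cong s
      (λ g′ → wordsAfter≡afterRun K (next s) k m g′ (suc-injective (trans (sym (+-suc k m)) eq))) g
    leading-ones : ∀ k → k + m ≡ suc K → wordsAfter run0 K m g ≡ powerSeries k m g
    leading-ones zero    m≡1+K = trans (wordsAfter-vanishing run0 K m g (subst (K <_) (sym m≡1+K) ≤-refl))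
                                       (cong (λ m → 1ₛ m g) (sym m≡1+K))
    leading-ones (suc k) eq    = trans (wordsAfter≡afterRun K run0 k m g (suc-injective eq))
                                       (cong (λ F → F m g) (sym (iterate-suc (afterRun run0) 1ₛ k)))

  -- Compositions

  weakCompositions : ℕ → ℕ → ℕ
  weakCompositions zero    L = 1
  weakCompositions (suc g) L = (L + g) C suc g

  weakCompositions-pascal : ∀ g L →
    weakCompositions (suc g) (suc L) ≡ weakCompositions g (suc L) + weakCompositions (suc g) L
  weakCompositions-pascal zero    L = C-pascal (L + 0) 0
  weakCompositions-pascal (suc g) L rewrite +-suc L g = C-pascal (suc (L + g)) (suc g)

  -- Of the h parts, L = m − h − g have size ≥ 2: choose them, then spread the excess g over them.
  compositions : ℕ → Series
  compositions h m g = shiftBy (h + g) (λ L → (h C L) * weakCompositions g L) m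

  compositions-vanishing : ∀ h m g → m < h → compositions h m g ≡ 0
  compositions-vanishing h m g m<h = shiftBy-below (h + g) _ m (≤-trans m<h (m≤m+n h g))

  geometric-compositions : ∀ h m g →
    geometric (compositions h) m g ≡ shiftBy (h + g) (λ L → (h C L) * weakCompositions g (suc L)) m
  geometric-compositions h zero    zero    = refl
  geometric-compositions h zero    (suc g) rewrite +-suc h g = refl
  geometric-compositions h (suc m) zero    = refl
  geometric-compositions h (suc m) (suc g) = begin
    compositions h (suc m) (suc g) + geometric (compositions h) m g
      ≡⟨ cong₂ _+_ (cong (λ a → shiftBy a f (suc m)) (+-suc h g)) (geometric-compositions h m g) ⟩
    shiftBy (h + g) f m + shiftBy (h + g) (λ L → (h C L) * weakCompositions g (suc L)) m
      ≡⟨ shiftBy-+ (h + g) f _ m ⟩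
    shiftBy (h + g) (λ L → (h C L) * weakCompositions (suc g) L + (h C L) * weakCompositions g (suc L)) m
      ≡⟨ shiftBy-cong (h + g) (λ L → trans (sym (*-distribˡ-+ (h C L) _ _))
           (cong ((h C L) *_) (trans (+-comm _ (weakCompositions g (suc L))) (sym (weakCompositions-pascal g L))))) m ⟩
    shiftBy (h + g) (λ L → (h C L) * weakCompositions (suc g) (suc L)) m
      ≡⟨ cong (λ a → shiftBy a (λ L → (h C L) * weakCompositions (suc g) (suc L)) (suc m)) (sym (+-suc h g)) ⟩
    shiftBy (h + suc g) (λ L → (h C L) * weakCompositions (suc g) (suc L)) (suc m) ∎
    where
    f : ℕ → ℕ
    f L = (h C L) * weakCompositions (suc g) L

  zeroBlock-compositions : ∀ h → zeroBlock (compositions h) ≋ compositions (suc h)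
  zeroBlock-compositions h zero    g = refl
  zeroBlock-compositions h (suc m) g = begin
    compositions h m g + (x· geometric (compositions h)) m g
      ≡⟨ cong (compositions h m g +_) (trans (after-x m) (sym (shiftBy-suc (h + g) f′ m))) ⟩
    shiftBy (h + g) f m + shiftBy (h + g) (shiftBy 1 f′) m
      ≡⟨ shiftBy-+ (h + g) f (shiftBy 1 f′) m ⟩
    shiftBy (h + g) (λ L → f L + shiftBy 1 f′ L) m
      ≡⟨ shiftBy-cong (h + g) pascal m ⟩
    shiftBy (h + g) (λ L → (suc h C L) * weakCompositions g L) m ∎
    where
    f f′ : ℕ → ℕ
    f  L = (h C L) * weakCompositions g L
    f′ L = (h C L) * weakCompositions g (suc L)
    after-x : ∀ m → (x· geometric (compositions h)) m g ≡ shiftBy (suc (h + g)) f′ m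
    after-x zero    = refl
    after-x (suc m) = geometric-compositions h m g
    pascal : ∀ L → f L + shiftBy 1 f′ L ≡ (suc h C L) * weakCompositions g L
    pascal zero    = +-identityʳ (f zero)
    pascal (suc L) = trans (+-comm (f (suc L)) _) (sym (trans (cong (_* weakCompositions g (suc L)) (C-pascal h L))
                                                              (*-distribʳ-+ (weakCompositions g (suc L)) (h C L) _)))

  compositions-0-excess : ∀ g m → compositions 0 m (suc g) ≡ 0
  compositions-0-excess g m = trans (shiftBy-cong (suc g) none m) (shiftBy-zero (suc g) m)
    where
    none : ∀ L → (0 C L) * weakCompositions (suc g) L ≡ 0
    none zero    = trans (+-identityʳ _) (k>n⇒nCk≡0 (n<1+n g))
    none (suc L) = refl

  1ₛ≋compositions-0 : 1ₛ ≋ compositions 0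
  1ₛ≋compositions-0 zero    zero    = refl
  1ₛ≋compositions-0 (suc m) zero    = refl
  1ₛ≋compositions-0 zero    (suc g) = sym (compositions-0-excess g zero)
  1ₛ≋compositions-0 (suc m) (suc g) = sym (compositions-0-excess g (suc m))

  zeroBlock^≋compositions : ∀ h → iterate zeroBlock 1ₛ h ≋ compositions h
  zeroBlock^≋compositions zero    = 1ₛ≋compositions-0
  zeroBlock^≋compositions (suc h) m g = begin
    iterate zeroBlock 1ₛ (suc h) m g   ≡⟨ cong (λ F → F m g) (iterate-suc zeroBlock 1ₛ h) ⟩
    zeroBlock (iterate zeroBlock 1ₛ h) m g ≡⟨ zeroBlock-cong (zeroBlock^≋compositions h) m g ⟩
    zeroBlock (compositions h) m g     ≡⟨ zeroBlock-compositions h m g ⟩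
    compositions (suc h) m g           ∎

  ⊖-minus : ∀ m a b → (m ⊖ a) ℤ.- ℤ.+ b ≡ m ⊖ (a + b)
  ⊖-minus m a zero    = trans (ℤP.+-identityʳ (m ⊖ a)) (cong (m ⊖_) (sym (+-identityʳ a)))
  ⊖-minus m a (suc b) = trans (ℤP.distribˡ-⊖-+-neg b m a) (cong (m ⊖_) (sym (+-suc a b)))

  binomZ-⊖ : ∀ k m a → binomZ k (m ⊖ a) ≡ shiftBy a (k C_) m
  binomZ-⊖ k m       zero    = refl
  binomZ-⊖ k zero    (suc a) = refl
  binomZ-⊖ k (suc m) (suc a) = trans (cong (binomZ k) (ℤP.[1+m]⊖[1+n]≡m⊖n m a)) (binomZ-⊖ k m a)

  binomZ-excess : ∀ k m g h ℓ → binomZ k (ℤ.+ m ℤ.- ℤ.+ g ℤ.- ℤ.+ h ℤ.- ℤ.+ ℓ) ≡ shiftBy (g + h + ℓ) (k C_) m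
  binomZ-excess k m g h ℓ = begin
    binomZ k (ℤ.+ m ℤ.- ℤ.+ g ℤ.- ℤ.+ h ℤ.- ℤ.+ ℓ)
      ≡⟨ cong (λ z → binomZ k (z ℤ.- ℤ.+ h ℤ.- ℤ.+ ℓ)) (ℤP.[+m]-[+n]≡m⊖n m g) ⟩
    binomZ k ((m ⊖ g) ℤ.- ℤ.+ h ℤ.- ℤ.+ ℓ)
      ≡⟨ cong (λ z → binomZ k (z ℤ.- ℤ.+ ℓ)) (⊖-minus m g h) ⟩
    binomZ k ((m ⊖ (g + h)) ℤ.- ℤ.+ ℓ)
      ≡⟨ cong (binomZ k) (⊖-minus m (g + h) ℓ) ⟩
    binomZ k (m ⊖ (g + h + ℓ))
      ≡⟨ binomZ-⊖ k m (g + h + ℓ) ⟩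
    shiftBy (g + h + ℓ) (k C_) m ∎

  binomZ≡compositions : ∀ h m → binomZ h (ℤ.+ m ℤ.- ℤ.+ h) ≡ compositions h m 0
  binomZ≡compositions h m = begin
    binomZ h (ℤ.+ m ℤ.- ℤ.+ h)   ≡⟨ cong (binomZ h) (ℤP.[+m]-[+n]≡m⊖n m h) ⟩
    binomZ h (m ⊖ h)         ≡⟨ binomZ-⊖ h m h ⟩
    shiftBy h (h C_) m       ≡⟨ cong (λ a → shiftBy a (h C_) m) (sym (+-identityʳ h)) ⟩
    shiftBy (h + 0) (h C_) m ≡⟨ shiftBy-cong (h + 0) (λ L → sym (*-identityʳ (h C L))) m ⟩
    compositions h m 0       ∎

  cPrime-numerator : ∀ h m g →
    sum0ℕ h (λ ℓ → ℓ * (h C ℓ) * (suc g C ℓ) * binomZ (h ∸ ℓ) (ℤ.+ m ℤ.- ℤ.+ suc g ℤ.- ℤ.+ h ℤ.- ℤ.+ ℓ))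
      ≡ suc g * compositions h m (suc g)
  cPrime-numerator h m g =
    trans (sum0ℕ-cong h (λ ℓ → cong (ℓ * (h C ℓ) * (G C ℓ) *_) (binomZ-excess (h ∸ ℓ) m G h ℓ)))
          (by-size (h + G ≤? m))
    where
    G = suc g
    term : ℕ → ℕ
    term ℓ = ℓ * (h C ℓ) * (G C ℓ) * shiftBy (G + h + ℓ) ((h ∸ ℓ) C_) m
    by-size : Dec (h + G ≤ m) → sum0ℕ h term ≡ G * compositions h m G
    by-size (no h+G≰m) = begin
      sum0ℕ h term
        ≡⟨ sum0ℕ-cong h (λ ℓ → trans (cong (ℓ * (h C ℓ) * (G C ℓ) *_)
                                             (shiftBy-below (G + h + ℓ) _ m (m<G+h+ℓ ℓ)))
                                       (*-zeroʳ (ℓ * (h C ℓ) * (G C ℓ)))) ⟩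
      sum0ℕ h (λ _ → 0)
        ≡⟨ trans (sum0ℕ-const h 0) (*-zeroʳ (suc h)) ⟩
      0
        ≡⟨ sym (trans (cong (G *_) (shiftBy-below (h + G) _ m (≰⇒> h+G≰m))) (*-zeroʳ G)) ⟩
      G * compositions h m G ∎
      where
      m<G+h+ℓ : ∀ ℓ → m < G + h + ℓ
      m<G+h+ℓ ℓ = <-≤-trans (≰⇒> h+G≰m) (≤-trans (≤-reflexive (+-comm h G)) (m≤m+n (G + h) ℓ))
    by-size (yes h+G≤m) = begin
      sum0ℕ h term
        ≡⟨ sum0ℕ-cong h revise ⟩
      sum0ℕ h (λ ℓ → (h C L) * (ℓ * (L C ℓ) * (G C ℓ)))
        ≡⟨ sum0ℕ-*ˡ h (h C L) _ ⟩
      (h C L) * sum0ℕ h (λ ℓ → ℓ * (L C ℓ) * (G C ℓ))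
        ≡⟨ by-parts (L ≤? h) ⟩
      G * ((h C L) * weakCompositions G L)
        ≡⟨ cong (G *_) (sym (trans (cong (λ k → compositions h k G) m≡h+G+L) (shiftBy-at (h + G) _ L))) ⟩
      G * compositions h m G ∎
      where
      L = m ∸ (h + G)
      m≡h+G+L : m ≡ h + G + L
      m≡h+G+L = sym (m+[n∸m]≡n h+G≤m)
      revise : ∀ ℓ → term ℓ ≡ (h C L) * (ℓ * (L C ℓ) * (G C ℓ))
      revise ℓ = begin
        ℓ * (h C ℓ) * (G C ℓ) * shiftBy (G + h + ℓ) ((h ∸ ℓ) C_) m
          ≡⟨ cong₂ (λ a k → ℓ * (h C ℓ) * (G C ℓ) * shiftBy (a + ℓ) ((h ∸ ℓ) C_) k) (+-comm G h) m≡h+G+L ⟩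
        ℓ * (h C ℓ) * (G C ℓ) * shiftBy (h + G + ℓ) ((h ∸ ℓ) C_) (h + G + L)
          ≡⟨ cong (ℓ * (h C ℓ) * (G C ℓ) *_) (shiftBy-offset (h + G) ℓ _ L) ⟩
        ℓ * (h C ℓ) * (G C ℓ) * shiftBy ℓ ((h ∸ ℓ) C_) L
          ≡⟨ solve 4 (λ l a b x → l :* a :* b :* x := l :* b :* (a :* x))
                     refl ℓ (h C ℓ) (G C ℓ) (shiftBy ℓ ((h ∸ ℓ) C_) L) ⟩
        ℓ * (G C ℓ) * ((h C ℓ) * shiftBy ℓ ((h ∸ ℓ) C_) L)
          ≡⟨ cong (ℓ * (G C ℓ) *_) (C-trinomial h ℓ L) ⟩
        ℓ * (G C ℓ) * ((h C L) * (L C ℓ))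
          ≡⟨ solve 4 (λ l b y z → l :* b :* (y :* z) := y :* (l :* z :* b)) refl ℓ (G C ℓ) (h C L) (L C ℓ) ⟩
        (h C L) * (ℓ * (L C ℓ) * (G C ℓ)) ∎
      by-parts : Dec (L ≤ h) → (h C L) * sum0ℕ h (λ ℓ → ℓ * (L C ℓ) * (G C ℓ)) ≡ G * ((h C L) * weakCompositions G L)
      by-parts (yes L≤h) = trans (cong ((h C L) *_) (sum-ℓ-C-C g L h L≤h))
                                 (solve 3 (λ y a b → y :* (a :* b) := a :* (y :* b)) refl (h C L) G (weakCompositions G L))
      by-parts (no L≰h)  = trans (cong (_* sum0ℕ h (λ ℓ → ℓ * (L C ℓ) * (G C ℓ))) hCL≡0)
                                 (sym (trans (cong (λ c → G * (c * weakCompositions G L)) hCL≡0) (*-zeroʳ G)))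
        where
        hCL≡0 : h C L ≡ 0
        hCL≡0 = k>n⇒nCk≡0 (≰⇒> L≰h)

  T000-closedForm : ∀ m n g → 1 ≤ n → 3 ≤ m + n →
    n * T000 m n g ≡ (m + n) * sum0ℕ (m ⊓ n) (λ h → compositions h m g * (n C h))
  T000-closedForm m (suc n) g _ 3≤N = begin
    suc n * T000 m (suc n) g
      ≡⟨ cyclic-count m (suc n) g (m + n) (+-suc m n) (≤-pred (subst (3 ≤_) (+-suc m n) 3≤N)) ⟩
    suc (m + n) * wordsAfter run0 (m + n) m g
      ≡⟨ cong₂ _*_ (sym (+-suc m n)) (wordsAfter≡afterRun (m + n) run0 n m g (+-comm n m)) ⟩
    (m + suc n) * afterRun run0 (powerSeries n) m g
      ≡⟨ cong (λ F → (m + suc n) * F m g) (sym (iterate-suc (afterRun run0) 1ₛ n)) ⟩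
    (m + suc n) * powerSeries (suc n) m g
      ≡⟨ cong ((m + suc n) *_) (binomial-expansion zeroBlock zeroBlock-cong zeroBlock-⊕ (suc n) 1ₛ m g) ⟩
    (m + suc n) * sum0ℕ (suc n) (λ h → (suc n C h) * iterate zeroBlock 1ₛ h m g)
      ≡⟨ cong ((m + suc n) *_) (sum0ℕ-cong (suc n) (λ h →
           trans (cong ((suc n C h) *_) (zeroBlock^≋compositions h m g)) (*-comm (suc n C h) _))) ⟩
    (m + suc n) * sum0ℕ (suc n) (λ h → compositions h m g * (suc n C h))
      ≡⟨ cong ((m + suc n) *_) (sym (sum0ℕ-⊓ m (suc n) _ (λ h m<h →
           cong (_* (suc n C h)) (compositions-vanishing h m g m<h)))) ⟩
    (m + suc n) * sum0ℕ (m ⊓ suc n) (λ h → compositions h m g * (suc n C h)) ∎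

open import Defs
open import Data.Nat as ℕ using (ℕ; zero; suc; _+_; _∸_; _≤_; _⊓_)
import Data.Nat.Properties as ℕP
open import Data.Nat.Combinatorics using (_C_)
import Data.Integer as ℤ
import Data.Integer.Properties as ℤP
open import Data.Rational using (ℚ; _*_)
import Data.Rational as ℚ
import Data.Rational.Properties as ℚP
import Data.Rational.Unnormalised as ℚᵘ
import Data.Rational.Unnormalised.Properties as ℚᵘP
open import Data.Product using (_×_; _,_)
open import Relation.Binary.PropositionalEquality
open ≡-Reasoning
open Counting
  using (compositions; C-absorption; cPrime-numerator; binomZ≡compositions; 1ₛ≋compositions-0; T000-closedForm)

fromℚᵘ-+ : ∀ p q → ℚ.fromℚᵘ p ℚ.+ ℚ.fromℚᵘ q ≡ ℚ.fromℚᵘ (p ℚᵘ.+ q)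
fromℚᵘ-+ p q = ℚP.toℚᵘ-injective (ℚᵘP.≃-trans (ℚP.toℚᵘ-homo-+ (ℚ.fromℚᵘ p) (ℚ.fromℚᵘ q))
  (ℚᵘP.≃-trans (ℚᵘP.+-cong (ℚP.toℚᵘ-fromℚᵘ p) (ℚP.toℚᵘ-fromℚᵘ q))
               (ℚᵘP.≃-sym (ℚP.toℚᵘ-fromℚᵘ (p ℚᵘ.+ q)))))

fromℚᵘ-* : ∀ p q → ℚ.fromℚᵘ p * ℚ.fromℚᵘ q ≡ ℚ.fromℚᵘ (p ℚᵘ.* q)
fromℚᵘ-* p q = ℚP.toℚᵘ-injective (ℚᵘP.≃-trans (ℚP.toℚᵘ-homo-* (ℚ.fromℚᵘ p) (ℚ.fromℚᵘ q))
  (ℚᵘP.≃-trans (ℚᵘP.*-cong (ℚP.toℚᵘ-fromℚᵘ p) (ℚP.toℚᵘ-fromℚᵘ q))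
               (ℚᵘP.≃-sym (ℚP.toℚᵘ-fromℚᵘ (p ℚᵘ.* q)))))

frac-cross : ∀ a b c d → a ℕ.* suc d ≡ c ℕ.* suc b → frac a (suc b) ≡ frac c (suc d)
frac-cross a b c d eq = ℚP.fromℚᵘ-cong {ℚᵘ.mkℚᵘ (ℤ.+ a) b} {ℚᵘ.mkℚᵘ (ℤ.+ c) d} (ℚᵘ.*≡* (begin
  ℤ.+ a ℤ.* ℤ.+ suc d ≡⟨ ℤP.pos-* a (suc d) ⟨
  ℤ.+ (a ℕ.* suc d)   ≡⟨ cong ℤ.+_ eq ⟩
  ℤ.+ (c ℕ.* suc b)   ≡⟨ ℤP.pos-* c (suc b) ⟩
  ℤ.+ c ℤ.* ℤ.+ suc b ∎))

frac-* : ∀ a b c d → frac a (suc b) * frac c (suc d) ≡ frac (a ℕ.* c) (suc b ℕ.* suc d)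
frac-* a b c d = trans (fromℚᵘ-* (ℚᵘ.mkℚᵘ (ℤ.+ a) b) (ℚᵘ.mkℚᵘ (ℤ.+ c) d))
  (ℚP.fromℚᵘ-cong {ℚᵘ.mkℚᵘ (ℤ.+ a) b ℚᵘ.* ℚᵘ.mkℚᵘ (ℤ.+ c) d}
                   {ℚᵘ.mkℚᵘ (ℤ.+ (a ℕ.* c)) (ℕ.pred (suc b ℕ.* suc d))}
    (ℚᵘ.*≡* (cong (ℤ._* ℤ.+ (suc b ℕ.* suc d)) (sym (ℤP.pos-* a c)))))

frac-+ : ∀ a b → frac a 1 ℚ.+ frac b 1 ≡ frac (a + b) 1
frac-+ a b = trans (fromℚᵘ-+ (ℚᵘ.mkℚᵘ (ℤ.+ a) 0) (ℚᵘ.mkℚᵘ (ℤ.+ b) 0))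
  (ℚP.fromℚᵘ-cong {ℚᵘ.mkℚᵘ (ℤ.+ a) 0 ℚᵘ.+ ℚᵘ.mkℚᵘ (ℤ.+ b) 0} {ℚᵘ.mkℚᵘ (ℤ.+ (a + b)) 0}
    (ℚᵘ.*≡* (cong (ℤ._* ℤ.+ 1) (begin
    ℤ.+ a ℤ.* ℤ.+ 1 ℤ.+ ℤ.+ b ℤ.* ℤ.+ 1
      ≡⟨ cong₂ ℤ._+_ (ℤP.*-identityʳ (ℤ.+ a)) (ℤP.*-identityʳ (ℤ.+ b)) ⟩
    ℤ.+ a ℤ.+ ℤ.+ b                     ≡⟨ ℤP.pos-+ a b ⟨
    ℤ.+ (a + b)                         ∎))))

sum1-cong : ∀ k {f g : ℕ → ℚ} → (∀ h → f (suc h) ≡ g (suc h)) → sum1 k f ≡ sum1 k g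
sum1-cong zero    f≗g = refl
sum1-cong (suc k) f≗g = cong₂ ℚ._+_ (sum1-cong k f≗g) (f≗g k)

sum1-*ˡ : ∀ k q f → sum1 k (λ h → q * f h) ≡ q * sum1 k f
sum1-*ˡ zero    q f = sym (ℚP.*-zeroʳ q)
sum1-*ˡ (suc k) q f = trans (cong (ℚ._+ q * f (suc k)) (sum1-*ˡ k q f)) (sym (ℚP.*-distribˡ-+ q (sum1 k f) (f (suc k))))

sum1-frac : ∀ k f → f 0 ≡ 0 → sum1 k (λ h → frac (f h) 1) ≡ frac (sum0ℕ k f) 1
sum1-frac zero    f f0≡0 = sym (cong (λ x → frac x 1) f0≡0)
sum1-frac (suc k) f f0≡0 = trans (cong (ℚ._+ frac (f (suc k)) 1) (sum1-frac k f f0≡0)) (frac-+ (sum0ℕ k f) (f (suc k)))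

cPrime≡compositions : ∀ m g h → cPrime m g h ≡ frac (compositions h m g) 1
cPrime≡compositions m zero    h = cong (λ x → frac x 1) (binomZ≡compositions h m)
cPrime≡compositions m (suc g) h =
  trans (cong (λ x → frac x (suc g)) (cPrime-numerator h m g))
        (frac-cross (suc g ℕ.* c) g c 0 (trans (ℕP.*-identityʳ (suc g ℕ.* c)) (ℕP.*-comm (suc g) c)))
  where c = compositions h m (suc g)

frac-absorption : ∀ N n h → frac N (suc h) * frac (n C h) 1 ≡ frac N (suc n) * frac (suc n C suc h) 1
frac-absorption N n h = begin
  frac N (suc h) * frac y 1            ≡⟨ frac-* N h y 0 ⟩
  frac (N ℕ.* y) (suc h ℕ.* 1)        ≡⟨ frac-cross (N ℕ.* y) (h ℕ.* 1) (N ℕ.* z) (n ℕ.* 1) cross ⟩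
  frac (N ℕ.* z) (suc n ℕ.* 1)        ≡⟨ frac-* N n z 0 ⟨
  frac N (suc n) * frac z 1            ∎
  where
  y = n C h
  z = suc n C suc h
  cross : N ℕ.* y ℕ.* (suc n ℕ.* 1) ≡ N ℕ.* z ℕ.* (suc h ℕ.* 1)
  cross = begin
    N ℕ.* y ℕ.* (suc n ℕ.* 1) ≡⟨ cong (N ℕ.* y ℕ.*_) (ℕP.*-identityʳ (suc n)) ⟩
    N ℕ.* y ℕ.* suc n         ≡⟨ ℕP.*-assoc N y (suc n) ⟩
    N ℕ.* (y ℕ.* suc n)       ≡⟨ cong (N ℕ.*_) (trans (ℕP.*-comm y (suc n)) (sym (C-absorption n h))) ⟩
    N ℕ.* (suc h ℕ.* z)       ≡⟨ cong (N ℕ.*_) (ℕP.*-comm (suc h) z) ⟩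
    N ℕ.* (z ℕ.* suc h)       ≡⟨ ℕP.*-assoc N z (suc h) ⟨
    N ℕ.* z ℕ.* suc h         ≡⟨ cong (N ℕ.* z ℕ.*_) (ℕP.*-identityʳ (suc h)) ⟨
    N ℕ.* z ℕ.* (suc h ℕ.* 1) ∎

rescale-term : ∀ N n h q → frac N (suc h) * q * frac (n C h) 1 ≡ frac N (suc n) * (q * frac (suc n C suc h) 1)
rescale-term N n h q = begin
  frac N (suc h) * q * frac (n C h) 1             ≡⟨ cong (_* frac (n C h) 1) (ℚP.*-comm (frac N (suc h)) q) ⟩
  q * frac N (suc h) * frac (n C h) 1             ≡⟨ ℚP.*-assoc q _ _ ⟩
  q * (frac N (suc h) * frac (n C h) 1)           ≡⟨ cong (q *_) (frac-absorption N n h) ⟩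
  q * (frac N (suc n) * frac (suc n C suc h) 1)   ≡⟨ ℚP.*-assoc q _ _ ⟨
  q * frac N (suc n) * frac (suc n C suc h) 1     ≡⟨ cong (_* frac (suc n C suc h) 1) (ℚP.*-comm q (frac N (suc n))) ⟩
  frac N (suc n) * q * frac (suc n C suc h) 1     ≡⟨ ℚP.*-assoc (frac N (suc n)) q _ ⟩
  frac N (suc n) * (q * frac (suc n C suc h) 1)   ∎

frac-quotient : ∀ t N n s → suc n ℕ.* t ≡ N ℕ.* s → frac t 1 ≡ frac N (suc n) * frac s 1
frac-quotient t N n s eq = sym (trans (frac-* N n s 0) (frac-cross (N ℕ.* s) (n ℕ.* 1) t 0 (begin
  N ℕ.* s ℕ.* 1        ≡⟨ ℕP.*-identityʳ (N ℕ.* s) ⟩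
  N ℕ.* s              ≡⟨ eq ⟨
  suc n ℕ.* t          ≡⟨ ℕP.*-comm (suc n) t ⟩
  t ℕ.* suc n          ≡⟨ cong (t ℕ.*_) (ℕP.*-identityʳ (suc n)) ⟨
  t ℕ.* (suc n ℕ.* 1)  ∎)))

sum1-cPrime : ∀ m n g k → 1 ≤ m →
  sum1 k (λ h → cPrime m g h * frac (n C h) 1) ≡ frac (sum0ℕ k (λ h → compositions h m g ℕ.* (n C h))) 1
sum1-cPrime (suc m) n g k _ = trans
  (sum1-cong k (λ h → trans (cong (_* frac (n C suc h) 1) (cPrime≡compositions (suc m) g (suc h)))
                            (frac-* (compositions (suc h) (suc m) g) 0 (n C suc h) 0)))
  (sum1-frac k _ (cong (ℕ._* (n C 0)) (sym (1ₛ≋compositions-0 (suc m) g))))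

mainTheorem14 : (m n g : ℕ) → 1 ≤ m → 1 ≤ n → 4 ≤ m + n →
    (frac (T000 m n g) 1
       ≡ sum1 (m ⊓ n) (λ h → frac (m + n) h * cPrime m g h * frac ((n ∸ 1) C (h ∸ 1)) 1))
    × (sum1 (m ⊓ n) (λ h → frac (m + n) h * cPrime m g h * frac ((n ∸ 1) C (h ∸ 1)) 1)
       ≡ frac (m + n) n * sum1 (m ⊓ n) (λ h → cPrime m g h * frac (n C h) 1))
mainTheorem14 m (suc n) g 1≤m 1≤n 4≤N = trans count (sym rescale) , rescale
  where
  N = m + suc n
  k = m ⊓ suc n
  rescale : sum1 k (λ h → frac N h * cPrime m g h * frac (n C (h ∸ 1)) 1)
          ≡ frac N (suc n) * sum1 k (λ h → cPrime m g h * frac (suc n C h) 1)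
  rescale = trans (sum1-cong k (λ h → rescale-term N n h (cPrime m g (suc h))))
                  (sum1-*ˡ k (frac N (suc n)) _)
  count : frac (T000 m (suc n) g) 1 ≡ frac N (suc n) * sum1 k (λ h → cPrime m g h * frac (suc n C h) 1)
  count = trans (frac-quotient (T000 m (suc n) g) N n _
                  (T000-closedForm m (suc n) g 1≤n (ℕP.≤-trans (ℕP.n≤1+n 3) 4≤N)))
                (cong (frac N (suc n) *_) (sym (sum1-cPrime m (suc n) g k 1≤m)))
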